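{- Let $\vec H$ be a DAG with $k$ vertices. Then $\operatorname{dtd}(\vec H)\le \lfloor k/4\rfloor+2$.
   Context: For a DAG $\vec H$, a source is a vertex of indegree $0$, and $R(s)$ is the set of vertices reachable from $s$ by a directed path. A DAG elimination forest of $\vec H$ is defined recursively: if $\vec H$ is empty, the forest is empty; if $\vec H$ has exactly one source (and is connected), it is a single node; if the underlying undirected graph is disconnected, it is the union of DAG elimination forests of the components; otherwise it is a tree obtained by picking any source $s$, deleting $s$ and all of $R(s)$, making $s$ the root and letting its subtrees be the trees of a DAG elimination forest of the remaining DAG. $\operatorname{dtd}(\vec H)$ is the minimum, over such forests, of the maximum number of nodes on a root-to-leaf path. -}

module Defs where

open import Level using (0ℓ)
open import Data.Nat using (ℕ; zero; suc; _⊔_)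
open import Data.Fin using (Fin)
open import Data.Bool using (Bool; true)
open import Data.Unit using (⊤)
open import Data.List using (List; []; _∷_; _++_)
open import Data.Product using (Σ; ∃; _×_; _,_)
open import Data.Sum using (_⊎_)
open import Relation.Binary.PropositionalEquality using (_≡_)
open import Relation.Nullary using (¬_)
open import Relation.Unary using (Pred; _∈_; _∉_; _⊆_; _∩_; ∁; Empty; Satisfiable)

record Digraph (k : ℕ) : Set where
  field
    adj : Fin k → Fin k → Bool

module _ {k : ℕ} (H : Digraph k) where
  open Digraph H

  Arc : Fin k → Fin k → Set
  Arc u v = adj u v ≡ true

  data Path⁺ : Fin k → Fin k → Set where
    one  : ∀ {u v} → Arc u v → Path⁺ u v
    cons : ∀ {u w v} → Arc u w → Path⁺ w v → Path⁺ u v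

  Acyclic : Set
  Acyclic = ∀ v → ¬ Path⁺ v v

  -- Everything below concerns the sub-DAG of H induced on a vertex set S.
  VSet : Set₁
  VSet = Pred (Fin k) 0ℓ

  IsSource : VSet → Fin k → Set
  IsSource S s = s ∈ S × (∀ u → u ∈ S → ¬ Arc u s)

  ExactlyOneSource : VSet → Set
  ExactlyOneSource S = Σ (Fin k) λ s → IsSource S s × (∀ t → IsSource S t → t ≡ s)

  -- R(s) in H[S]: vertices reachable from u by a directed path inside S
  -- (the trivial path included, so u ∈ R(u)).
  data Reach (S : VSet) : Fin k → Fin k → Set where
    here : ∀ {u} → u ∈ S → Reach S u u
    step : ∀ {u w v} → u ∈ S → Arc u w → Reach S w v → Reach S u v

  R : VSet → Fin k → VSet
  R S s v = Reach S s v

  Adj : Fin k → Fin k → Set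
  Adj u v = Arc u v ⊎ Arc v u

  data UPath (S : VSet) : Fin k → Fin k → Set where
    here : ∀ {u} → u ∈ S → UPath S u u
    step : ∀ {u w v} → u ∈ S → Adj u w → UPath S w v → UPath S u v

  Connected : VSet → Set
  Connected S = Satisfiable S × (∀ u v → u ∈ S → v ∈ S → UPath S u v)

  IsComponent : VSet → VSet → Set
  IsComponent S T =
    T ⊆ S × Connected T ×
    (∀ u v → u ∈ T → v ∈ S → v ∉ T → ¬ Adj u v)

data Tree (k : ℕ) : Set where
  node : Fin k → List (Tree k) → Tree k

Forest : ℕ → Set
Forest k = List (Tree k)

-- maximum number of nodes on a root-to-leaf path
mutual
  depthT : ∀ {k} → Tree k → ℕ
  depthT (node _ ts) = suc (depthF ts)

  depthF : ∀ {k} → Forest k → ℕ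
  depthF []       = 0
  depthF (t ∷ ts) = depthT t ⊔ depthF ts

module _ {k : ℕ} (H : Digraph k) where

  -- IsDEF S F : F is a DAG elimination forest of H[S] (recursive definition
  -- of the paper; the disconnected case splits off one connected component
  -- at a time, which yields the union of the forests of all components).
  data IsDEF (S : VSet H) : Forest k → Set₁ where
    empty  : Empty S → IsDEF S []
    single : ∀ s → IsSource H S s → (∀ t → IsSource H S t → t ≡ s) →
             Connected H S → IsDEF S (node s [] ∷ [])
    split  : ∀ (T : VSet H) {F₁ F₂} → Satisfiable S → ¬ Connected H S →
             IsComponent H S T →
             IsDEF T F₁ → IsDEF (S ∩ ∁ T) F₂ → IsDEF S (F₁ ++ F₂)
    root   : ∀ s {F} → Connected H S → ¬ ExactlyOneSource H S →
             IsSource H S s →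
             IsDEF (S ∩ ∁ (R H S s)) F → IsDEF S (node s F ∷ [])

  All : VSet H
  All _ = ⊤

-- A connected DAG C on N vertices with a single source is a single node. If some source s
-- reaches at least four vertices, root at s: every component of C − R(s) has at most N − 4
-- vertices, so induction gives depth 1 + (2 + (N − 4) / 4) = 2 + N / 4.
-- Otherwise every source reaches at most three vertices, a property inherited by the components
-- of C − R(s). Such a component D has an arc x → y into R(s); a source u above x lies
-- in D and also reaches y, so either D has a single source or u reaches exactly two vertices of D
-- and three of C. DAGs with a source u reaching exactly two vertices u, d satisfy the sharper
-- bound 2 + (N − 1) / 4: root at a source v reaching three vertices including d if there is one
-- (then u's component is {u} and every other component has at most N − 4 vertices), and at u
-- otherwise (then every component has a single source). In the remaining case root at any source,
-- which reaches exactly three vertices, and apply the sharper bound to the components.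

module Submission where

open import Defs
open import Level using (0ℓ)
open import Data.Nat using (ℕ; zero; suc; pred; _+_; _∸_; _≤_; _<_; _⊔_; z≤n; s≤s; _≤?_; _≟_)
open import Data.Nat.Properties
open import Data.Nat.DivMod using (_/_; m/n≡1+[m∸n]/n; /-monoˡ-≤)
open import Data.Fin using (Fin; zero; suc)
open import Data.Fin.Properties using (any?; all?) renaming (_≟_ to _≟ᶠ_; suc-injective to Fin-suc-injective)
open import Data.Bool using (true)
open import Data.Bool.Properties using () renaming (_≟_ to _≟ᵇ_)
open import Data.Product using (Σ; ∃-syntax; _×_; _,_; proj₁; proj₂)
open import Data.Sum using (_⊎_; inj₁; inj₂; [_,_]′)
open import Data.Empty using (⊥; ⊥-elim)
open import Data.List using (List; []; _∷_; _++_; length)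
open import Data.List.Relation.Unary.All as All using ([]; _∷_)
open import Data.List.Relation.Unary.Any as Any using (here; there)
open import Data.List.Membership.Propositional using (_∈_)
open import Data.List.Relation.Unary.All.Properties using (¬Any⇒All¬)
open import Data.List.Relation.Unary.Any.Properties using (¬Any[])
open import Data.List.Relation.Unary.AllPairs using ([]; _∷_)
open import Data.List.Relation.Unary.Unique.Propositional using (Unique)
open import Function using (_∘_)
open import Relation.Nullary using (¬_; Dec; yes; no; contradiction)
open import Relation.Nullary.Decidable using (_×-dec_; _⊎-dec_; ¬?; _→-dec_; map′)
open import Relation.Unary using (Pred; Decidable; _∩_; ∁; _⊆_; Empty; Satisfiable)
  renaming (_∈_ to _∈ₛ_; _∉_ to _∉ₛ_)
open import Relation.Unary.Properties using (_∩?_; ∁?; U?)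
open import Relation.Binary.PropositionalEquality using (_≡_; _≢_; refl; sym; trans; cong; subst; module ≡-Reasoning)

-- Counting the elements of decidable vertex sets

VertexSet : ℕ → Set₁
VertexSet k = Pred (Fin k) 0ℓ

private
  variable
    k : ℕ

count : {P : VertexSet k} → Decidable P → ℕ
count {k = zero}  P? = 0
count {k = suc k} P? with P? zero
... | yes _ = suc (count (P? ∘ suc))
... | no  _ = count (P? ∘ suc)

count-mono : {P Q : VertexSet k} (P? : Decidable P) (Q? : Decidable Q) → P ⊆ Q → count P? ≤ count Q?
count-mono {k = zero}  P? Q? P⊆Q = z≤n
count-mono {k = suc k} P? Q? P⊆Q with P? zero | Q? zero
... | yes _ | yes _ = s≤s (count-mono (P? ∘ suc) (Q? ∘ suc) P⊆Q)
... | yes p | no ¬q = contradiction (P⊆Q p) ¬q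
... | no _  | yes _ = m≤n⇒m≤1+n (count-mono (P? ∘ suc) (Q? ∘ suc) P⊆Q)
... | no _  | no _  = count-mono (P? ∘ suc) (Q? ∘ suc) P⊆Q

count-cong : {P Q : VertexSet k} (P? : Decidable P) (Q? : Decidable Q) → P ⊆ Q → Q ⊆ P → count P? ≡ count Q?
count-cong P? Q? P⊆Q Q⊆P = ≤-antisym (count-mono P? Q? P⊆Q) (count-mono Q? P? Q⊆P)

count-≤ : {P : VertexSet k} (P? : Decidable P) → count P? ≤ k
count-≤ P? = ≤-trans (count-mono P? U? _) count-U
  where
  count-U : ∀ {k} → count {k} U? ≤ k
  count-U {zero}  = z≤n
  count-U {suc k} = s≤s count-U

count-none : {P : VertexSet k} (P? : Decidable P) → Empty P → count P? ≡ 0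
count-none {k = zero}  P? ∅ = refl
count-none {k = suc k} P? ∅ with P? zero
... | yes p = ⊥-elim (∅ zero p)
... | no  _ = count-none (P? ∘ suc) (∅ ∘ suc)

0<count : {P : VertexSet k} (P? : Decidable P) {x : Fin k} → x ∈ₛ P → 0 < count P?
0<count {k = suc k} P? {zero} p with P? zero
... | yes _ = s≤s z≤n
... | no ¬p = contradiction p ¬p
0<count {k = suc k} P? {suc x} p with P? zero
... | yes _ = s≤s z≤n
... | no  _ = 0<count (P? ∘ suc) p

0<count⇒satisfiable : {P : VertexSet k} (P? : Decidable P) → 0 < count P? → Satisfiable P
0<count⇒satisfiable P? 0<c with any? P?
... | yes sat = sat
... | no ¬sat = contradiction (count-none P? (λ x p → ¬sat (x , p))) (>⇒≢ 0<c)

count-singleton : (x : Fin k) (≡x? : Decidable (_≡ x)) → count ≡x? ≡ 1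
count-singleton {k = suc k} zero ≡x? with ≡x? zero
... | yes _  = cong suc (count-none (≡x? ∘ suc) (λ _ ()))
... | no ¬eq = contradiction refl ¬eq
count-singleton {k = suc k} (suc x) ≡x? with ≡x? zero
... | no _ = trans (count-cong (≡x? ∘ suc) (_≟ᶠ x) Fin-suc-injective (cong suc))
                   (count-singleton x (_≟ᶠ x))

count-split : {P Q : VertexSet k} (P? : Decidable P) (Q? : Decidable Q) →
              count P? ≡ count (P? ∩? Q?) + count (P? ∩? ∁? Q?)
count-split {k = zero}  P? Q? = refl
count-split {k = suc k} P? Q? with P? zero | Q? zero
... | yes _ | yes _ = cong suc (count-split (P? ∘ suc) (Q? ∘ suc))
... | yes _ | no  _ = trans (cong suc (count-split (P? ∘ suc) (Q? ∘ suc))) (sym (+-suc _ _))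
... | no  _ | yes _ = count-split (P? ∘ suc) (Q? ∘ suc)
... | no  _ | no  _ = count-split (P? ∘ suc) (Q? ∘ suc)

count-remove : {P : VertexSet k} (P? : Decidable P) {x : Fin k} → x ∈ₛ P →
               count P? ≡ suc (count (P? ∩? ∁? (_≟ᶠ x)))
count-remove P? {x} p = begin
  count P?                                           ≡⟨ count-split P? (_≟ᶠ x) ⟩
  count (P? ∩? (_≟ᶠ x)) + count (P? ∩? ∁? (_≟ᶠ x))  ≡⟨ cong (_+ count (P? ∩? ∁? (_≟ᶠ x))) singleton ⟩
  suc (count (P? ∩? ∁? (_≟ᶠ x)))                     ∎
  where
  open ≡-Reasoning
  singleton : count (P? ∩? (_≟ᶠ x)) ≡ 1
  singleton = trans (count-cong _ (_≟ᶠ x) proj₂ (λ { refl → p , refl })) (count-singleton x _)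

count≤length : {P : VertexSet k} (P? : Decidable P) (xs : List (Fin k)) → P ⊆ (_∈ xs) → count P? ≤ length xs
count≤length P? []       P⊆[] = ≤-reflexive (count-none P? (λ _ → ¬Any[] ∘ P⊆[]))
count≤length {P = P} P? (x ∷ xs) P⊆x∷xs = begin
  count P?                                           ≡⟨ count-split P? (_≟ᶠ x) ⟩
  count (P? ∩? (_≟ᶠ x)) + count (P? ∩? ∁? (_≟ᶠ x))  ≤⟨ +-mono-≤ atMostOne (count≤length _ xs P-x⊆xs) ⟩
  suc (length xs)                                    ∎
  where
  open ≤-Reasoning
  atMostOne : count (P? ∩? (_≟ᶠ x)) ≤ 1
  atMostOne = ≤-trans (count-mono _ (_≟ᶠ x) proj₂) (≤-reflexive (count-singleton x _))
  P-x⊆xs : P ∩ ∁ (_≡ x) ⊆ (_∈ xs)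
  P-x⊆xs (p , y≢x) with P⊆x∷xs p
  ... | here y≡x = contradiction y≡x y≢x
  ... | there y∈xs = y∈xs

length≤count : {P : VertexSet k} (P? : Decidable P) {xs : List (Fin k)} → Unique xs → All.All P xs → length xs ≤ count P?
length≤count P? []                []         = z≤n
length≤count P? {x ∷ xs} (x∉xs ∷ unique) (px ∷ pxs) = begin
  suc (length xs)                 ≤⟨ s≤s (length≤count _ unique (All.zip (pxs , All.map (_∘ sym) x∉xs))) ⟩
  suc (count (P? ∩? ∁? (_≟ᶠ x)))  ≡⟨ count-remove P? px ⟨
  count P?                        ∎
  where open ≤-Reasoning

count≤length⇒⊆ : {P : VertexSet k} (P? : Decidable P) {xs : List (Fin k)} → Unique xs → All.All P xs →
                 count P? ≤ length xs → P ⊆ (_∈ xs)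
count≤length⇒⊆ P? {xs} unique pxs count≤ {x} px with Any.any? (x ≟ᶠ_) xs
... | yes x∈xs = x∈xs
... | no  x∉xs = contradiction (length≤count P? (¬Any⇒All¬ xs x∉xs ∷ unique) (px ∷ pxs)) (<⇒≱ (s≤s count≤))

count-∩∁< : {P Q : VertexSet k} (P? : Decidable P) (Q? : Decidable Q) {x : Fin k} →
            x ∈ₛ P → x ∈ₛ Q → count (P? ∩? ∁? Q?) < count P?
count-∩∁< P? Q? px qx = begin-strict
  count (P? ∩? ∁? Q?)                       <⟨ m<n+m _ (0<count (P? ∩? Q?) (px , qx)) ⟩
  count (P? ∩? Q?) + count (P? ∩? ∁? Q?)   ≡⟨ count-split P? Q? ⟨
  count P?                                  ∎
  where open ≤-Reasoning

count≡2⇒pair : {P : VertexSet k} (P? : Decidable P) {x : Fin k} → count P? ≡ 2 → x ∈ₛ P →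
               ∃[ y ] y ∈ₛ P × x ≢ y × P ⊆ (_∈ x ∷ y ∷ [])
count≡2⇒pair P? {x} count≡2 px with 0<count⇒satisfiable (P? ∩? ∁? (_≟ᶠ x)) 0<count-x
  where
  0<count-x : 0 < count (P? ∩? ∁? (_≟ᶠ x))
  0<count-x = ≤-pred (≤-reflexive (trans (sym count≡2) (count-remove P? px)))
... | y , py , y≢x = y , py , x≢y , count≤length⇒⊆ P? ((x≢y ∷ []) ∷ [] ∷ []) (px ∷ py ∷ []) (≤-reflexive count≡2)
  where
  x≢y : x ≢ y
  x≢y = y≢x ∘ sym

-- Written 2 + n / 4 so that bound n ∸ 1 reduces to 1 + n / 4.
bound : ℕ → ℕ
bound n = 2 + n / 4

bound-mono : ∀ {m n} → m ≤ n → bound m ≤ bound n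
bound-mono m≤n = s≤s (s≤s (/-monoˡ-≤ 4 m≤n))

bound-+4 : ∀ {m n} → m + 4 ≤ n → bound m ≤ bound n ∸ 1
bound-+4 {m} {n} m+4≤n = s≤s (begin
  suc (m / 4)            ≡⟨ cong (λ x → suc (x / 4)) (m+n∸n≡m m 4) ⟨
  suc ((m + 4 ∸ 4) / 4)  ≡⟨ m/n≡1+[m∸n]/n (m≤n+m 4 m) ⟨
  (m + 4) / 4            ≤⟨ /-monoˡ-≤ 4 m+4≤n ⟩
  n / 4                  ∎)
  where open ≤-Reasoning

pred+4≤ : ∀ {d n} → 1 ≤ d → d + 3 ≤ n → pred d + 4 ≤ n
pred+4≤ {suc d} {n} _ 1+d+3≤n = subst (_≤ n) (sym (+-suc d 3)) 1+d+3≤n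

-- Walks, reachability and connected components

data Walk (E : Fin k → Fin k → Set) (S : VertexSet k) : Fin k → Fin k → Set where
  here : ∀ {u} → u ∈ₛ S → Walk E S u u
  step : ∀ {u w v} → u ∈ₛ S → E u w → Walk E S w v → Walk E S u v

module _ {E : Fin k → Fin k → Set} where

  walk-∈ˡ : ∀ {S u v} → Walk E S u v → u ∈ₛ S
  walk-∈ˡ (here u∈S)     = u∈S
  walk-∈ˡ (step u∈S _ _) = u∈S

  walk-mono : ∀ {S T} → S ⊆ T → ∀ {u v} → Walk E S u v → Walk E T u v
  walk-mono S⊆T (here u∈S)        = here (S⊆T u∈S)
  walk-mono S⊆T (step u∈S e walk) = step (S⊆T u∈S) e (walk-mono S⊆T walk)

  walk-last-visit : ∀ {S a u v} → Walk E S a v → u ≢ v →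
                    Walk E (S ∩ ∁ (_≡ u)) a v ⊎ ∃[ w ] E u w × Walk E (S ∩ ∁ (_≡ u)) w v
  walk-last-visit (here a∈S) u≢v = inj₁ (here (a∈S , λ { refl → u≢v refl }))
  walk-last-visit {u = u} (step {a} a∈S e walk) u≢v with walk-last-visit walk u≢v
  ... | inj₂ exit  = inj₂ exit
  ... | inj₁ avoid with a ≟ᶠ u
  ...   | yes refl = inj₂ (_ , e , avoid)
  ...   | no  a≢u  = inj₁ (step (a∈S , a≢u) e avoid)

  walk? : (∀ x y → Dec (E x y)) → ∀ {S} → Decidable S → ∀ u v → Dec (Walk E S u v)
  walk? E? S? = search _ S? ≤-refl
    where
    search : ∀ n {S} (S? : Decidable S) → count S? ≤ n → ∀ u v → Dec (Walk E S u v)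
    search zero S? count≤0 u v = no λ walk → <⇒≱ (0<count S? (walk-∈ˡ walk)) count≤0
    search (suc n) S? count≤ u v with S? u
    ... | no  u∉S = no (u∉S ∘ walk-∈ˡ)
    ... | yes u∈S with u ≟ᶠ v
    ...   | yes refl = yes (here u∈S)
    ...   | no  u≢v with any? (λ w → E? u w ×-dec search n (S? ∩? ∁? (_≟ᶠ u)) count-u≤ w v)
      where
      count-u≤ : count (S? ∩? ∁? (_≟ᶠ u)) ≤ n
      count-u≤ = ≤-pred (subst (_≤ suc n) (count-remove S? u∈S) count≤)
    ...     | yes (w , e , walk) = yes (step u∈S e (walk-mono proj₁ walk))
    ...     | no  ¬exit          = no λ walk →
                [ (λ avoid → proj₂ (walk-∈ˡ avoid) refl) , ¬exit ]′ (walk-last-visit walk u≢v)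

module _ (H : Digraph k) where

  arc? : ∀ u v → Dec (Arc H u v)
  arc? u v = Digraph.adj H u v ≟ᵇ true

  adj? : ∀ u v → Dec (Adj H u v)
  adj? u v = arc? u v ⊎-dec arc? v u

  reach? : ∀ {S} → Decidable S → ∀ u v → Dec (Reach H S u v)
  reach? S? u v = map′ toReach fromReach (walk? arc? S? u v)
    where
    toReach : ∀ {S u v} → Walk (Arc H) S u v → Reach H S u v
    toReach (here u∈S)        = here u∈S
    toReach (step u∈S a walk) = step u∈S a (toReach walk)
    fromReach : ∀ {S u v} → Reach H S u v → Walk (Arc H) S u v
    fromReach (here u∈S)     = here u∈S
    fromReach (step u∈S a r) = step u∈S a (fromReach r)

  upath? : ∀ {S} → Decidable S → ∀ u v → Dec (UPath H S u v)
  upath? S? u v = map′ toUPath fromUPath (walk? adj? S? u v)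
    where
    toUPath : ∀ {S u v} → Walk (Adj H) S u v → UPath H S u v
    toUPath (here u∈S)        = here u∈S
    toUPath (step u∈S a walk) = step u∈S a (toUPath walk)
    fromUPath : ∀ {S u v} → UPath H S u v → Walk (Adj H) S u v
    fromUPath (here u∈S)     = here u∈S
    fromUPath (step u∈S a p) = step u∈S a (fromUPath p)

  adj-sym : ∀ {u v} → Adj H u v → Adj H v u
  adj-sym (inj₁ a) = inj₂ a
  adj-sym (inj₂ a) = inj₁ a

  source? : ∀ {S} → Decidable S → Decidable (IsSource H S)
  source? S? s = S? s ×-dec all? (λ u → S? u →-dec ¬? (arc? u s))

  exactlyOneSource? : ∀ {S} → Decidable S → Dec (ExactlyOneSource H S)
  exactlyOneSource? S? = any? (λ s → source? S? s ×-dec all? (λ t → source? S? t →-dec (t ≟ᶠ s)))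

  connected? : ∀ {S} → Decidable S → Dec (Connected H S)
  connected? S? = any? S? ×-dec all? (λ u → all? (λ v → S? u →-dec (S? v →-dec upath? S? u v)))

  reach-∈ˡ : ∀ {S u v} → Reach H S u v → u ∈ₛ S
  reach-∈ˡ (here u∈S)     = u∈S
  reach-∈ˡ (step u∈S _ _) = u∈S

  reach-∈ʳ : ∀ {S u v} → Reach H S u v → v ∈ₛ S
  reach-∈ʳ (here v∈S)   = v∈S
  reach-∈ʳ (step _ _ r) = reach-∈ʳ r

  reach-mono : ∀ {S T} → S ⊆ T → ∀ {u v} → Reach H S u v → Reach H T u v
  reach-mono S⊆T (here u∈S)     = here (S⊆T u∈S)
  reach-mono S⊆T (step u∈S a r) = step (S⊆T u∈S) a (reach-mono S⊆T r)

  reach-trans : ∀ {S u w v} → Reach H S u w → Reach H S w v → Reach H S u v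
  reach-trans (here _)       r′ = r′
  reach-trans (step u∈S a r) r′ = step u∈S a (reach-trans r r′)

  reach-snoc : ∀ {S u w v} → Reach H S u w → Arc H w v → v ∈ₛ S → Reach H S u v
  reach-snoc r a v∈S = reach-trans r (step (reach-∈ʳ r) a (here v∈S))

  arc-reach⇒path⁺ : ∀ {S u w v} → Arc H u w → Reach H S w v → Path⁺ H u v
  arc-reach⇒path⁺ a (here _)     = one a
  arc-reach⇒path⁺ a (step _ a′ r) = cons a (arc-reach⇒path⁺ a′ r)

  reach-into-source : ∀ {S u t} → IsSource H S t → Reach H S u t → u ≡ t
  reach-into-source _                (here _)       = refl
  reach-into-source src@(_ , noArcIn) (step u∈S a r) with reach-into-source src r
  ... | refl = ⊥-elim (noArcIn _ u∈S a)

  upath-∈ˡ : ∀ {S u v} → UPath H S u v → u ∈ₛ S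
  upath-∈ˡ (here u∈S)     = u∈S
  upath-∈ˡ (step u∈S _ _) = u∈S

  upath-∈ʳ : ∀ {S u v} → UPath H S u v → v ∈ₛ S
  upath-∈ʳ (here v∈S)   = v∈S
  upath-∈ʳ (step _ _ p) = upath-∈ʳ p

  upath-trans : ∀ {S u w v} → UPath H S u w → UPath H S w v → UPath H S u v
  upath-trans (here _)       p′ = p′
  upath-trans (step u∈S a p) p′ = step u∈S a (upath-trans p p′)

  upath-snoc : ∀ {S u w v} → UPath H S u w → Adj H w v → v ∈ₛ S → UPath H S u v
  upath-snoc p a v∈S = upath-trans p (step (upath-∈ʳ p) a (here v∈S))

  upath-reverse : ∀ {S u v} → UPath H S u v → UPath H S v u
  upath-reverse (here u∈S)     = here u∈S
  upath-reverse (step u∈S a p) = upath-snoc (upath-reverse p) (adj-sym a) u∈S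

  upath-exit : ∀ {S D : VertexSet k} → Decidable D → ∀ {a b} → UPath H S a b → a ∈ₛ D → b ∉ₛ D →
               ∃[ x ] ∃[ y ] x ∈ₛ D × y ∈ₛ S × y ∉ₛ D × Adj H x y
  upath-exit D? (here _) a∈D b∉D = contradiction a∈D b∉D
  upath-exit D? (step {a} {w} _ a-w p) a∈D b∉D with D? w
  ... | yes w∈D = upath-exit D? p w∈D b∉D
  ... | no  w∉D = a , w , a∈D , upath-∈ˡ p , w∉D , a-w

  component-self : ∀ {S} → Connected H S → IsComponent H S S
  component-self conn = (λ x∈S → x∈S) , conn , (λ _ _ _ v∈S v∉S _ → v∉S v∈S)

  component-of : ∀ {S v} → v ∈ₛ S → IsComponent H S (UPath H S v)
  component-of {S} {v} v∈S =
    upath-∈ʳ , ((v , here v∈S) , λ a b v-a v-b → within (upath-trans (upath-reverse v-a) v-b) v-a) ,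
    λ _ _ v-u w∈S v↛w u-w → v↛w (upath-snoc v-u u-w w∈S)
    where
    within : ∀ {a b} → UPath H S a b → UPath H S v a → UPath H (UPath H S v) a b
    within (here _)     v-a = here v-a
    within (step _ a-w p) v-a = step v-a a-w (within p (upath-snoc v-a a-w (upath-∈ˡ p)))

  component-of-complement : ∀ {S T D : VertexSet k} → Decidable T → (∀ {a b} → a ∈ₛ T → Adj H a b → b ∈ₛ S → b ∈ₛ T) →
                            IsComponent H (S ∩ ∁ T) D → IsComponent H S D
  component-of-complement {S} {T} {D} T? T-closed (D⊆ , conn , D-closed) = proj₁ ∘ D⊆ , conn , closed
    where
    closed : ∀ u w → u ∈ₛ D → w ∈ₛ S → w ∉ₛ D → ¬ Adj H u w
    closed u w u∈D w∈S w∉D u-w with T? w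
    ... | yes w∈T = proj₂ (D⊆ u∈D) (T-closed w∈T (adj-sym u-w) (proj₁ (D⊆ u∈D)))
    ... | no  w∉T = D-closed u w u∈D (w∈S , w∉T) w∉D u-w

  -- Building DAG elimination forests

  DEF≤ : VertexSet k → ℕ → Set₁
  DEF≤ S B = Σ (Forest k) λ F → IsDEF H S F × depthF F ≤ B

  def-weaken : ∀ {S B B′} → B ≤ B′ → DEF≤ S B → DEF≤ S B′
  def-weaken B≤B′ (F , def , depth≤B) = F , def , ≤-trans depth≤B B≤B′

  def-single : ∀ {S B} → ExactlyOneSource H S → Connected H S → 1 ≤ B → DEF≤ S B
  def-single (s , src , unique) conn 1≤B = node s [] ∷ [] , single s src unique conn , ⊔-lub 1≤B z≤n

  def-root : ∀ {S s B} → Connected H S → ¬ ExactlyOneSource H S → IsSource H S s →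
             DEF≤ (S ∩ ∁ (R H S s)) B → DEF≤ S (suc B)
  def-root {s = s} conn ¬unique src (F , def , depth≤B) =
    node s F ∷ [] , root s conn ¬unique src def , ⊔-lub (s≤s depth≤B) z≤n

  depthF-++ : (F₁ F₂ : Forest k) → depthF (F₁ ++ F₂) ≡ depthF F₁ ⊔ depthF F₂
  depthF-++ []       F₂ = refl
  depthF-++ (t ∷ F₁) F₂ = trans (cong (depthT t ⊔_) (depthF-++ F₁ F₂)) (sym (⊔-assoc (depthT t) (depthF F₁) (depthF F₂)))

  def-components : ∀ {S B} → Decidable S → (∀ {D} → Decidable D → IsComponent H S D → DEF≤ D B) → DEF≤ S B
  def-components S? = split-off _ S? ≤-refl
    where
    split-off : ∀ n {S B} (S? : Decidable S) → count S? ≤ n →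
                (∀ {D} → Decidable D → IsComponent H S D → DEF≤ D B) → DEF≤ S B
    split-off zero S? count≤0 _ = [] , empty (λ x x∈S → <⇒≱ (0<count S? x∈S) count≤0) , z≤n
    split-off (suc n) {S} S? count≤ defOf with any? S?
    ... | no  ¬sat = [] , empty (λ x x∈S → ¬sat (x , x∈S)) , z≤n
    ... | yes (v , v∈S) with connected? S?
    ...   | yes conn = defOf S? (component-self conn)
    ...   | no ¬conn with defOf (upath? S? v) (component-of v∈S)
                        | split-off n (S? ∩? ∁? (upath? S? v)) count-rest≤
                            (λ D? comp → defOf D? (component-of-complement (upath? S? v)
                                                     (λ v-a a-b b∈S → upath-snoc v-a a-b b∈S) comp))
      where
      count-rest≤ : count (S? ∩? ∁? (upath? S? v)) ≤ n
      count-rest≤ = ≤-pred (≤-trans (count-∩∁< S? (upath? S? v) v∈S (here v∈S)) count≤)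
    ... | F₁ , def₁ , depth₁ | F₂ , def₂ , depth₂ =
      F₁ ++ F₂ , split (UPath H S v) (v , v∈S) ¬conn (component-of v∈S) def₁ def₂ ,
      subst (_≤ _) (sym (depthF-++ F₁ F₂)) (⊔-lub depth₁ depth₂)

  def-root-components : ∀ {S s B} (S? : Decidable S) → Connected H S → ¬ ExactlyOneSource H S → IsSource H S s →
                        (∀ {D} → Decidable D → IsComponent H (S ∩ ∁ (R H S s)) D → DEF≤ D B) → DEF≤ S (suc B)
  def-root-components {s = s} S? conn ¬unique s-src defOf =
    def-root conn ¬unique s-src (def-components (S? ∩? ∁? (reach? S? s)) defOf)

  source-restrict : ∀ {C D t} → D ⊆ C → t ∈ₛ D → IsSource H C t → IsSource H D t
  source-restrict D⊆C t∈D (_ , noArcIn) = t∈D , λ u u∈D → noArcIn u (D⊆C u∈D)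

  reachCount : ∀ {C} → Decidable C → Fin k → ℕ
  reachCount C? u = count (reach? C? u)

  SourcesReach≤ : ∀ {C} → Decidable C → ℕ → Set
  SourcesReach≤ {C} C? m = ∀ t → IsSource H C t → reachCount C? t ≤ m

  ¬large⇒sources-reach≤ : ∀ {C} (C? : Decidable C) m → ¬ (∃[ s ] IsSource H C s × m < reachCount C? s) →
                     SourcesReach≤ C? m
  ¬large⇒sources-reach≤ C? m ¬large t t-src = ≮⇒≥ (λ m<reach → ¬large (t , t-src , m<reach))

  count-rest : ∀ {C} (C? : Decidable C) s → count (C? ∩? ∁? (reach? C? s)) + reachCount C? s ≡ count C?
  count-rest C? s = begin
    count (C? ∩? ∁? (reach? C? s)) + reachCount C? s            ≡⟨ +-comm _ (reachCount C? s) ⟩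
    reachCount C? s + count (C? ∩? ∁? (reach? C? s))            ≡⟨ cong (_+ count (C? ∩? ∁? (reach? C? s))) reach⊆C ⟩
    count (C? ∩? reach? C? s) + count (C? ∩? ∁? (reach? C? s))  ≡⟨ count-split C? (reach? C? s) ⟨
    count C?                                                    ∎
    where
    open ≡-Reasoning
    reach⊆C : reachCount C? s ≡ count (C? ∩? reach? C? s)
    reach⊆C = count-cong (reach? C? s) (C? ∩? reach? C? s) (λ r → reach-∈ʳ r , r) proj₂

  -- Acyclic digraphs

  module _ (acyclic : Acyclic H) where

    no-arc-back : ∀ {S u w} → Arc H u w → ¬ Reach H S w u
    no-arc-back u→w w⇝u = acyclic _ (arc-reach⇒path⁺ u→w w⇝u)

    -- Climbing along in-arcs terminates because the ancestors of the current vertex strictly shrink.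
    source-above : ∀ {C} → Decidable C → ∀ {y} → y ∈ₛ C → ∃[ u ] IsSource H C u × Reach H C u y
    source-above {C} C? y∈C = climb _ y∈C ≤-refl
      where
      ancestors? : ∀ y → Decidable (λ z → Reach H C z y)
      ancestors? y z = reach? C? z y
      climb : ∀ n {y} → y ∈ₛ C → count (ancestors? y) ≤ n → ∃[ u ] IsSource H C u × Reach H C u y
      climb zero y∈C count≤0 = contradiction count≤0 (<⇒≱ (0<count (ancestors? _) (here y∈C)))
      climb (suc n) {y} y∈C count≤ with any? (λ u → C? u ×-dec arc? u y)
      ... | no ¬arcIn = y , (y∈C , λ u u∈C u→y → ¬arcIn (u , u∈C , u→y)) , here y∈C
      ... | yes (u , u∈C , u→y) with climb n u∈C count-u≤
        where
        ancestors-u⊆ : (λ z → Reach H C z u) ⊆ (λ z → Reach H C z y) ∩ ∁ (_≡ y)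
        ancestors-u⊆ z⇝u = reach-snoc z⇝u u→y y∈C , λ { refl → no-arc-back u→y z⇝u }
        count-u≤ : count (ancestors? u) ≤ n
        count-u≤ = ≤-pred (≤-trans (s≤s (count-mono (ancestors? u) _ ancestors-u⊆))
                                   (subst (_≤ suc n) (count-remove (ancestors? y) (here y∈C)) count≤))
      ... | s , s-src , s⇝u = s , s-src , reach-snoc s⇝u u→y y∈C

    lone-source : ∀ {D u t} → UPath H D u t → IsSource H D u → (∀ {z} → Reach H D u z → z ≡ u) → t ≡ u
    lone-source (here _) _ _ = refl
    lone-source (step u∈D (inj₁ u→w) p) _ only-u with only-u (step u∈D u→w (here (upath-∈ˡ p)))
    ... | refl = ⊥-elim (acyclic _ (one u→w))
    lone-source (step _ (inj₂ w→u) p) (_ , noArcIn) _ = ⊥-elim (noArcIn _ (upath-∈ˡ p) w→u)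

    lone-source⇒exactlyOne : ∀ {D u} → Connected H D → IsSource H D u →
                             (∀ {z} → Reach H D u z → z ≡ u) → ExactlyOneSource H D
    lone-source⇒exactlyOne {u = u} (_ , conn) u-src only-u =
      u , u-src , λ t t-src → lone-source (conn u t (proj₁ u-src) (proj₁ t-src)) u-src only-u

    module RestComponent {C} (C? : Decidable C) {s} (s∈C : s ∈ₛ C)
                         {D} (D? : Decidable D) (comp : IsComponent H (C ∩ ∁ (R H C s)) D) where

      D⊆C : D ⊆ C
      D⊆C = proj₁ ∘ proj₁ comp

      D-unreached : ∀ {x} → x ∈ₛ D → ¬ Reach H C s x
      D-unreached = proj₂ ∘ proj₁ comp

      s∉D : s ∉ₛ D
      s∉D s∈D = D-unreached s∈D (here s∈C)

      D-connected : Connected H D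
      D-connected = proj₁ (proj₂ comp)

      D-closed : ∀ u v → u ∈ₛ D → v ∈ₛ C ∩ ∁ (R H C s) → v ∉ₛ D → ¬ Adj H u v
      D-closed = proj₂ (proj₂ comp)

      count-D+reach≤ : count D? + reachCount C? s ≤ count C?
      count-D+reach≤ = ≤-trans (+-monoˡ-≤ _ (count-mono D? (C? ∩? ∁? (reach? C? s)) (proj₁ comp)))
                               (≤-reflexive (count-rest C? s))

      reach-into : ∀ {a x} → Reach H C a x → x ∈ₛ D → Reach H D a x
      reach-into (here _) x∈D = here x∈D
      reach-into (step {a} a∈C a→w w⇝x) x∈D with reach-into w⇝x x∈D | D? a
      ... | w⇝ᴰx | yes a∈D = step a∈D a→w w⇝ᴰx
      ... | w⇝ᴰx | no  a∉D with reach? C? s a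
      ...   | yes s⇝a = contradiction (reach-trans s⇝a (step a∈C a→w w⇝x)) (D-unreached x∈D)
      ...   | no  s↛a = contradiction (inj₂ a→w) (D-closed _ a (reach-∈ˡ w⇝ᴰx) (a∈C , s↛a) a∉D)

      source-lift : ∀ {t} → IsSource H D t → IsSource H C t
      source-lift {t} (t∈D , noArcIn) = D⊆C t∈D , noArcInC
        where
        noArcInC : ∀ u → u ∈ₛ C → ¬ Arc H u t
        noArcInC u u∈C u→t with D? u
        ... | yes u∈D = noArcIn u u∈D u→t
        ... | no  u∉D = D-closed t u t∈D (u∈C , λ s⇝u → D-unreached t∈D (reach-snoc s⇝u u→t (D⊆C t∈D)))
                                 u∉D (inj₂ u→t)

      exit-arc : Connected H C → ∃[ x ] ∃[ y ] x ∈ₛ D × Reach H C s y × Arc H x y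
      exit-arc (_ , C-conn) with proj₁ D-connected
      ... | x₀ , x₀∈D with upath-exit D? (C-conn x₀ s (D⊆C x₀∈D) s∈C) x₀∈D s∉D
      ... | x , y , x∈D , y∈C , y∉D , x-y with reach? C? s y
      ...   | no  s↛y = contradiction x-y (D-closed x y x∈D (y∈C , s↛y) y∉D)
      ...   | yes s⇝y with x-y
      ...     | inj₁ x→y = x , y , x∈D , s⇝y , x→y
      ...     | inj₂ y→x = contradiction (reach-snoc s⇝y y→x (D⊆C x∈D)) (D-unreached x∈D)

      0<count-D : 0 < count D?
      0<count-D = 0<count D? (proj₂ (proj₁ D-connected))

      count-D< : count D? < count C?
      count-D< = <-≤-trans (m<m+n (count D?) (0<count (reach? C? s) (here s∈C))) count-D+reach≤

      count-D+reach< : ∀ {u} → u ∈ₛ C ∩ ∁ (R H C s) → u ∉ₛ D → count D? + reachCount C? s < count C?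
      count-D+reach< {u} u∈rest u∉D = begin-strict
        count D? + reachCount C? s         <⟨ +-monoˡ-< (reachCount C? s) count-D<rest ⟩
        count rest? + reachCount C? s      ≡⟨ count-rest C? s ⟩
        count C?                           ∎
        where
        open ≤-Reasoning
        rest? : Decidable (C ∩ ∁ (R H C s))
        rest? = C? ∩? ∁? (reach? C? s)
        count-D<rest : count D? < count rest?
        count-D<rest = ≤-<-trans (count-mono D? (rest? ∩? ∁? (_≟ᶠ u)) (λ x∈D → proj₁ comp x∈D , λ { refl → u∉D x∈D }))
                                 (count-∩∁< rest? (_≟ᶠ u) u∈rest refl)

      sources-reach≤ : ∀ {m} → SourcesReach≤ C? m → SourcesReach≤ D? m
      sources-reach≤ C-sources≤ t t-src =
        ≤-trans (count-mono (reach? D? t) (reach? C? t) (reach-mono D⊆C)) (C-sources≤ t (source-lift t-src))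

      pair-source-isolated : ∀ {u d} → u ∈ₛ D → IsSource H C u → R H C u ⊆ (_∈ u ∷ d ∷ []) → Reach H C s d →
                             ∀ {t} → t ∈ₛ D → t ≡ u
      pair-source-isolated {u} u∈D u-src reach⊆ud s⇝d t∈D =
        lone-source (proj₂ D-connected u _ u∈D t∈D) (source-restrict D⊆C u∈D u-src) only-u
        where
        only-u : ∀ {z} → Reach H D u z → z ≡ u
        only-u u⇝z with reach⊆ud (reach-mono D⊆C u⇝z)
        ... | here z≡u          = z≡u
        ... | there (here refl) = contradiction s⇝d (D-unreached (reach-∈ʳ u⇝z))

      exit-source : Connected H C → ∃[ u ] ∃[ y ] IsSource H D u × y ∉ₛ D × Reach H C s y × Reach H C u y
      exit-source C-conn with exit-arc C-conn
      ... | x , y , x∈D , s⇝y , x→y with source-above C? (D⊆C x∈D)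
      ... | u , u-src , u⇝x =
        u , y , source-restrict D⊆C (reach-∈ˡ (reach-into u⇝x x∈D)) u-src ,
        (λ y∈D → D-unreached y∈D s⇝y) , s⇝y , reach-snoc u⇝x x→y (reach-∈ʳ s⇝y)

      -- The source u of D found below reaches a vertex y of R(s) outside D; if it also reaches
      -- some z ≠ u inside D, then u, z, y already exhaust the at most three vertices it reaches.
      dichotomy : Connected H C → SourcesReach≤ C? 3 →
                  ExactlyOneSource H D ⊎
                  ∃[ u ] IsSource H D u × reachCount D? u ≡ 2 × reachCount C? u ≡ 3 ×
                         ∃[ y ] Reach H C s y × Reach H C u y
      dichotomy C-conn sources≤3 with exit-source C-conn
      ... | u , y , u-src , y∉D , s⇝y , u⇝y with any? (λ z → reach? D? u z ×-dec ¬? (z ≟ᶠ u))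
      ...   | no ¬other = inj₁ (lone-source⇒exactlyOne D-connected u-src only-u)
        where
        only-u : ∀ {z} → Reach H D u z → z ≡ u
        only-u {z} u⇝z with z ≟ᶠ u
        ... | yes z≡u = z≡u
        ... | no  z≢u = contradiction (z , u⇝z , z≢u) ¬other
      ...   | yes (z , u⇝z , z≢u) = inj₂ (u , u-src , reachD≡2 , reachC≡3 , y , s⇝y , u⇝y)
        where
        u∈D : u ∈ₛ D
        u∈D = proj₁ u-src
        unique-uzy : Unique (u ∷ z ∷ y ∷ [])
        unique-uzy = ((z≢u ∘ sym) ∷ (λ { refl → y∉D u∈D }) ∷ [])
                   ∷ ((λ { refl → y∉D (reach-∈ʳ u⇝z) }) ∷ []) ∷ [] ∷ []
        reached : All.All (R H C u) (u ∷ z ∷ y ∷ [])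
        reached = here (D⊆C u∈D) ∷ reach-mono D⊆C u⇝z ∷ u⇝y ∷ []
        reachC≤3 : reachCount C? u ≤ 3
        reachC≤3 = sources≤3 u (source-lift u-src)
        reachC≡3 : reachCount C? u ≡ 3
        reachC≡3 = ≤-antisym reachC≤3 (length≤count (reach? C? u) unique-uzy reached)
        reachD⊆ : R H D u ⊆ (_∈ u ∷ z ∷ [])
        reachD⊆ u⇝w with count≤length⇒⊆ (reach? C? u) unique-uzy reached reachC≤3 (reach-mono D⊆C u⇝w)
        ... | here w≡u                 = here w≡u
        ... | there (here w≡z)         = there (here w≡z)
        ... | there (there (here refl)) = ⊥-elim (y∉D (reach-∈ʳ u⇝w))
        reachD≡2 : reachCount D? u ≡ 2
        reachD≡2 = ≤-antisym (count≤length (reach? D? u) _ reachD⊆)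
                             (length≤count (reach? D? u) (((z≢u ∘ sym) ∷ []) ∷ [] ∷ []) (here u∈D ∷ u⇝z ∷ []))

    PairSourceBound : ℕ → Set₁
    PairSourceBound n = ∀ {C} (C? : Decidable C) → count C? ≤ n → Connected H C → SourcesReach≤ C? 3 →
                        ∀ {u} → IsSource H C u → reachCount C? u ≡ 2 → DEF≤ C (bound (pred (count C?)))

    pair-source-bound : ∀ n → PairSourceBound n
    pair-source-bound zero C? count≤0 conn _ _ _ = contradiction count≤0 (<⇒≱ (0<count C? (proj₂ (proj₁ conn))))
    pair-source-bound (suc n) {C} C? count≤ conn sources≤3 {u} u-src reach≡2 with exactlyOneSource? C?
    ... | yes unique = def-single unique conn (s≤s z≤n)
    ... | no ¬unique with count≡2⇒pair (reach? C? u) reach≡2 (here (proj₁ u-src))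
    ... | d , _ , _ , reach⊆ud with any? (λ v → source? C? v ×-dec (reachCount C? v ≟ 3 ×-dec reach? C? v d))
    ...   | yes (v , v-src , reach≡3 , v⇝d) = def-root-components C? conn ¬unique v-src components
      where
      components : ∀ {D} → Decidable D → IsComponent H (C ∩ ∁ (R H C v)) D →
                   DEF≤ D (bound (pred (count C?)) ∸ 1)
      components {D} D? comp with RestComponent.dichotomy C? (proj₁ v-src) D? comp conn sources≤3
      ... | inj₁ unique = def-single unique (proj₁ (proj₂ comp)) (s≤s z≤n)
      ... | inj₂ (u′ , u′-src , reach′≡2 , _) =
        def-weaken (bound-+4 (pred+4≤ 0<count-D count-D+3≤))
                   (pair-source-bound n D? (≤-pred (≤-trans count-D< count≤)) D-connected
                                      (sources-reach≤ sources≤3) u′-src reach′≡2)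
        where
        open RestComponent C? (proj₁ v-src) D? comp
        v↛u : ¬ Reach H C v u
        v↛u v⇝u with reach-into-source u-src v⇝u
        ... | refl = contradiction (trans (sym reach≡3) reach≡2) λ ()
        u∉D : u ∉ₛ D
        u∉D u∈D = contradiction (begin
          2                 ≡⟨ reach′≡2 ⟨
          reachCount D? u′  ≤⟨ count-mono (reach? D? u′) D? reach-∈ʳ ⟩
          count D?          ≤⟨ count≤length D? (u ∷ []) (λ t∈D → here (pair-source-isolated u∈D u-src reach⊆ud v⇝d t∈D)) ⟩
          1                 ∎) λ { (s≤s ()) }
          where open ≤-Reasoning
        count-D+3≤ : count D? + 3 ≤ pred (count C?)
        count-D+3≤ = suc[m]≤n⇒m≤pred[n]
          (subst (λ r → count D? + r < count C?) reach≡3 (count-D+reach< (proj₁ u-src , v↛u) u∉D))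
    ...   | no ¬v = def-weaken (s≤s (s≤s z≤n)) (def-root-components C? conn ¬unique u-src components)
      where
      components : ∀ {D} → Decidable D → IsComponent H (C ∩ ∁ (R H C u)) D → DEF≤ D 1
      components D? comp with RestComponent.dichotomy C? (proj₁ u-src) D? comp conn sources≤3
      ... | inj₁ unique = def-single unique (proj₁ (proj₂ comp)) ≤-refl
      ... | inj₂ (u′ , u′-src , _ , reach′≡3 , y , u⇝y , u′⇝y) = ⊥-elim (y-case (reach⊆ud u⇝y))
        where
        open RestComponent C? (proj₁ u-src) D? comp
        y-case : y ∈ u ∷ d ∷ [] → ⊥
        y-case (here refl) with reach-into-source u-src u′⇝y
        ... | refl = D-unreached (proj₁ u′-src) (here (proj₁ u-src))
        y-case (there (here refl)) = ¬v (u′ , source-lift u′-src , reach′≡3 , u′⇝y)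

    ConnectedBound : ℕ → Set₁
    ConnectedBound n = ∀ {C} (C? : Decidable C) → count C? ≤ n → Connected H C → DEF≤ C (bound (count C?))

    connected-bound : ∀ n → ConnectedBound n
    connected-bound zero C? count≤0 conn = contradiction count≤0 (<⇒≱ (0<count C? (proj₂ (proj₁ conn))))
    connected-bound (suc n) {C} C? count≤ conn with exactlyOneSource? C?
    ... | yes unique = def-single unique conn (s≤s z≤n)
    ... | no ¬unique with any? (λ s → source? C? s ×-dec (4 ≤? reachCount C? s))
    ...   | yes (s , s-src , 4≤reach) = def-root-components C? conn ¬unique s-src components
      where
      components : ∀ {D} → Decidable D → IsComponent H (C ∩ ∁ (R H C s)) D → DEF≤ D (bound (count C?) ∸ 1)
      components D? comp =
        def-weaken (bound-+4 (≤-trans (+-monoʳ-≤ (count D?) 4≤reach) count-D+reach≤))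
                   (connected-bound n D? (≤-pred (≤-trans count-D< count≤)) D-connected)
        where open RestComponent C? (proj₁ s-src) D? comp
    ...   | no ¬large with ¬large⇒sources-reach≤ C? 3 ¬large | any? (λ u → source? C? u ×-dec (reachCount C? u ≟ 2))
    ...     | sources≤3 | yes (u , u-src , reach≡2) =
      def-weaken (bound-mono (pred[n]≤n {count C?})) (pair-source-bound (suc n) C? count≤ conn sources≤3 u-src reach≡2)
    ...     | sources≤3 | no ¬pair with source-above C? (proj₂ (proj₁ conn))
    ...       | s , s-src , _ = def-root-components C? conn ¬unique s-src components
      where
      3≤reach : 3 ≤ reachCount C? s
      3≤reach with reachCount C? s in reach≡ | 0<count (reach? C? s) (here (proj₁ s-src))
      ... | 1 | _ = ⊥-elim (¬unique (lone-source⇒exactlyOne conn s-src only-s))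
        where
        only-s : ∀ {z} → Reach H C s z → z ≡ s
        only-s s⇝z with count≤length⇒⊆ (reach? C? s) ([] ∷ []) (here (proj₁ s-src) ∷ []) (≤-reflexive reach≡) s⇝z
        ... | here z≡s = z≡s
      ... | 2 | _ = ⊥-elim (¬pair (s , s-src , reach≡))
      ... | suc (suc (suc _)) | _ = s≤s (s≤s (s≤s z≤n))
      components : ∀ {D} → Decidable D → IsComponent H (C ∩ ∁ (R H C s)) D → DEF≤ D (bound (count C?) ∸ 1)
      components D? comp with RestComponent.dichotomy C? (proj₁ s-src) D? comp conn sources≤3
      ... | inj₁ unique = def-single unique (proj₁ (proj₂ comp)) (s≤s z≤n)
      ... | inj₂ (u′ , u′-src , reach′≡2 , _) =
        def-weaken (bound-+4 (pred+4≤ 0<count-D (≤-trans (+-monoʳ-≤ (count D?) 3≤reach) count-D+reach≤)))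
                   (pair-source-bound n D? (≤-pred (≤-trans count-D< count≤)) D-connected
                                      (sources-reach≤ sources≤3) u′-src reach′≡2)
        where open RestComponent C? (proj₁ s-src) D? comp

mainTheorem11 : (k : ℕ) (H : Digraph k) → Acyclic H →
    Σ (Forest k) λ F → IsDEF H (All H) F × depthF F ≤ k / 4 + 2
mainTheorem11 k H acyclic =
  def-weaken H (≤-reflexive (+-comm 2 (k / 4))) (def-components H U? λ D? comp →
    def-weaken H (bound-mono (count-≤ D?)) (connected-bound H acyclic _ D? ≤-refl (proj₁ (proj₂ comp))))
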